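{- $\mathrm{OPT}(A) \le \mathrm{OPT}(S) + w(\mathrm{CYC}(G_S))$.
   Context: Setting: SCS-RC instance $S$ over $\{\texttt a,\texttt t,\texttt g,\texttt c\}$ (for each $s_i$, either $s_i$ or its reverse complement $\bar{s_i}^R$ must appear), $\mathrm{OPT}(\cdot)$ the optimal SCS-RC length, $S\cup\bar{S}^R$ substring-free, $s'\in\{s,\bar{s}^R\}$. $\mathrm{ov}(x,y)$ is the maximal proper overlap, $\mathrm{pref}(x,y)$ the part of $x$ before it, $\mathrm{dist}(x,y)=|x|-\mathrm{ov}(x,y)$, $\langle x_1,\dots,x_r\rangle=\mathrm{pref}(x_1,x_2)\cdots\mathrm{pref}(x_{r-1},x_r)x_r$. $G_S$ is the complete digraph on $S\cup\bar{S}^R$ weighted by $\mathrm{dist}$; $\mathrm{CYC}(G_S)$ is a minimum-weight cycle cover (vertex-disjoint cycles containing exactly one of $s_i,\bar{s_i}^R$ per $i$), with weight $w(\mathrm{CYC}(G_S))$. For each cycle $C=s_{i_1}',\dots,s_{i_r}',s_{i_1}'$ in $\mathrm{CYC}(G_S)$ there exist a string $x_C$ and an index $j$ such that $\langle s_{i_{j+1}}',\dots,s_{i_r}',s_{i_1}',\dots,s_{i_j}'\rangle$ is a suffix of $x_C$, $x_C$ is contained in $y_C=\langle s_{i_j}',\dots,s_{i_r}',s_{i_1}',\dots,s_{i_j}'\rangle$, and $x_C$ is a critical rotation (satisfying $\mathrm{ov}(x_D,x_C)\le w(D)+\frac12 w(C)$ for other cycles $D$). $A=\{x_C: C\in\mathrm{CYC}(G_S)\}$,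 viewed as an SCS-RC instance. -}

module Defs where

open import Data.Nat using (ℕ; zero; suc; _+_; _*_; _∸_; _≤_; _<_; pred; _⊓_)
open import Data.Bool using (Bool; true; false)
open import Data.Fin using (Fin)
open import Data.List using (List; []; _∷_; _++_; length; reverse; map; take; drop; concat; tabulate; allFin; _∷ʳ_; zipWith)
open import Data.List.Properties using (≡-dec)
open import Data.Nat.ListAction using (sum)
open import Data.List.Relation.Binary.Permutation.Propositional using (_↭_)
open import Data.Product using (Σ; _×_; _,_; ∃; ∃-syntax; proj₁)
open import Data.Sum using (_⊎_)
open import Relation.Binary.PropositionalEquality using (_≡_; refl)
open import Relation.Nullary using (Dec; yes; no)
open import Relation.Binary.Definitions using (DecidableEquality)

data Base : Set where
  a t g c : Base

comp : Base → Base
comp a = t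
comp t = a
comp g = c
comp c = g

_≟B_ : DecidableEquality Base
a ≟B a = yes refl
a ≟B t = no λ ()
a ≟B g = no λ ()
a ≟B c = no λ ()
t ≟B a = no λ ()
t ≟B t = yes refl
t ≟B g = no λ ()
t ≟B c = no λ ()
g ≟B a = no λ ()
g ≟B t = no λ ()
g ≟B g = yes refl
g ≟B c = no λ ()
c ≟B a = no λ ()
c ≟B t = no λ ()
c ≟B g = no λ ()
c ≟B c = yes refl

Str : Set
Str = List Base

_≟S_ : DecidableEquality Str
_≟S_ = ≡-dec _≟B_

rc : Str → Str
rc s = reverse (map comp s)

_⊑_ : Str → Str → Set
x ⊑ y = ∃[ u ] ∃[ v ] (u ++ x ++ v ≡ y)

Suffix : Str → Str → Set
Suffix x y = ∃[ u ] (u ++ x ≡ y)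

ovFrom : ℕ → Str → Str → ℕ
ovFrom zero    x y = zero
ovFrom (suc k) x y with drop (length x ∸ suc k) x ≟S take (suc k) y
... | yes _ = suc k
... | no  _ = ovFrom k x y

-- maximal proper overlap: length strictly below min(|x|,|y|)
ov : Str → Str → ℕ
ov x y = ovFrom (pred (length x ⊓ length y)) x y

pref : Str → Str → Str
pref x y = take (length x ∸ ov x y) x

dist : Str → Str → ℕ
dist x y = length x ∸ ov x y

merge : List Str → Str
merge []           = []
merge (x ∷ [])     = x
merge (x ∷ y ∷ xs) = pref x y ++ merge (y ∷ xs)

IsSol : ∀ {n} → (Fin n → Str) → Str → Set
IsSol {n} S w = ∀ (i : Fin n) → (S i ⊑ w) ⊎ (rc (S i) ⊑ w)

IsOPT : ∀ {n} → (Fin n → Str) → ℕ → Set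
IsOPT S k = (∃[ w ] (IsSol S w × length w ≡ k)) × (∀ w → IsSol S w → k ≤ length w)

-- vertices of G_S: pairs (i , b); b = true is s_i, b = false is rc(s_i)

orient : ∀ {n} → (Fin n → Str) → Fin n × Bool → Str
orient S (i , true)  = S i
orient S (i , false) = rc (S i)

-- S ∪ \bar{S}^R is substring-free (as a set of strings)
SubstringFree : ∀ {n} → (Fin n → Str) → Set
SubstringFree S = ∀ u v → orient S u ⊑ orient S v → orient S u ≡ orient S v

-- S is a set of strings: equal vertex strings come from the same index
-- (so the pairs {s_i, rc s_i} are well defined)
WellIndexed : ∀ {n} → (Fin n → Str) → Set
WellIndexed S = ∀ u v → orient S u ≡ orient S v → proj₁ u ≡ proj₁ v

rot : ∀ {A : Set} → ℕ → List A → List A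
rot k xs = drop k xs ++ take k xs

-- a cycle v₁,…,v_r,v₁ of G_S as the list [v₁,…,v_r]
Cycle : ℕ → Set
Cycle n = List (Fin n × Bool)

cycStrs : ∀ {n} → (Fin n → Str) → Cycle n → List Str
cycStrs S C = map (orient S) C

cycW : ∀ {n} → (Fin n → Str) → Cycle n → ℕ
cycW S C = sum (zipWith dist (cycStrs S C) (rot 1 (cycStrs S C)))

coverW : ∀ {n m} → (Fin n → Str) → (Fin m → Cycle n) → ℕ
coverW S CC = sum (tabulate (λ d → cycW S (CC d)))

NonEmpty : ∀ {A : Set} → List A → Set
NonEmpty xs = ∃[ y ] ∃[ ys ] (xs ≡ y ∷ ys)

-- vertex-disjoint non-empty cycles containing exactly one of s_i, rc(s_i) per i
IsCycleCover : ∀ {n m} → (Fin m → Cycle n) → Set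
IsCycleCover {n} {m} CC =
  (∀ d → NonEmpty (CC d)) × (map proj₁ (concat (tabulate CC)) ↭ allFin n)

IsMinCycleCover : ∀ {n m} → (Fin n → Str) → (Fin m → Cycle n) → Set
IsMinCycleCover {n} S CC =
  IsCycleCover CC × (∀ {m'} (CC' : Fin m' → Cycle n) → IsCycleCover CC' → coverW S CC ≤ coverW S CC')

-- x_C for a cycle C = [s'_{i_1},…,s'_{i_r}]: for some rotation
-- [s'_{i_j}, s'_{i_{j+1}}, …, s'_{i_{j-1}}] = u ∷ rest of C,
-- ⟨s'_{i_{j+1}},…,s'_{i_j}⟩ = merge (rest ∷ʳ u) is a suffix of x_C and
-- x_C ⊑ y_C = ⟨s'_{i_j},…,s'_{i_j}⟩ = merge (u ∷ rest ∷ʳ u)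
RotationString : List Str → Str → Set
RotationString C x =
  ∃[ k ] ∃[ u ] ∃[ rest ]
    (k < length C × rot k C ≡ u ∷ rest ×
     Suffix (merge (rest ∷ʳ u)) x × x ⊑ merge (u ∷ (rest ∷ʳ u)))

-- Fix a shortest solution w of S. Every cycle C of the cover yields a string
-- y_C = u ++ Q = Q' ++ u in which u is one of the strings of C and
-- |Q| = |Q'| = w(C); replacing y_C by its reverse complement if necessary,
-- u (or rc u) occurs in w, and x_C or rc x_C is a factor of y_C. Since the
-- borders of different cycles come from different input strings, they are
-- pairwise incomparable for ⊑, so their occurrences in w are ordered by
-- position; scanning w from left to right and inserting Q right after each
-- border occurrence turns w into a string of length |w| + Σ w(C) containing
-- every y_C, hence solving A.
module Submission where

open import Defs
open import Data.Bool using (Bool; true; false; not)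
open import Data.Empty using (⊥; ⊥-elim)
open import Data.Fin using (Fin; zero; suc)
open import Data.List
  using (List; []; _∷_; _++_; _∷ʳ_; [_]; length; map; reverse; take; drop; concat; tabulate; zipWith)
open import Data.List.Membership.Propositional using (_∈_)
open import Data.List.Membership.Propositional.Properties
  using (∈-map⁺; ∈-map⁻; ∈-++⁺ʳ; ∈-concat⁺′; ∈-tabulate⁺)
open import Data.List.Properties
  using (∷-injective; ++-assoc; ++-identityʳ; length-++; length-take; length-reverse; length-map;
         reverse-++; reverse-involutive; reverse-map; map-++; map-∘; map-cong; map-id; take++drop≡id;
         drop-all; concat-map; map-tabulate; tabulate-cong)
open import Data.List.Relation.Binary.Permutation.Propositional
  using (_↭_; ↭-sym; ↭-trans; ↭-reflexive; ↭⇒↭ₛ)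
import Data.List.Relation.Binary.Permutation.Propositional.Properties as ↭
open ↭ using (∈-resp-↭)
open import Data.List.Relation.Unary.All as All using (All; []; _∷_)
open import Data.List.Relation.Unary.All.Properties using (─⁺; ─⁻; tabulate⁺; tabulate⁻)
open import Data.List.Relation.Unary.AllPairs using (AllPairs; []; _∷_)
import Data.List.Relation.Unary.AllPairs.Properties as AllPairsₚ
open import Data.List.Relation.Unary.Any as Any using (Any; here; there; _─_)
open import Data.List.Relation.Unary.Any.Properties using (lookup-result)
open import Data.List.Relation.Unary.Unique.Propositional using (Unique)
open import Data.List.Relation.Unary.Unique.Propositional.Properties using (allFin⁺)
open import Data.Nat using (ℕ; zero; suc; _+_; _*_; _∸_; _≤_; z≤n; s≤s; pred; _⊓_)
open import Data.Nat.ListAction using (sum)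
open import Data.Nat.Properties
  using (≤-refl; ≤-trans; +-identityʳ; +-assoc; +-comm; +-monoʳ-≤; +-cancelˡ-≡; m∸n≤m; m≤n⇒m⊓n≡m;
         +-commutativeSemigroup)
open import Algebra.Properties.CommutativeSemigroup +-commutativeSemigroup using (x∙yz≈y∙xz)
open import Data.Product using (∃-syntax; _×_; _,_; proj₁; proj₂)
open import Data.Sum as Sum using (_⊎_; inj₁; inj₂)
open import Function using (_∘_; _on_)
open import Level using (0ℓ)
open import Relation.Binary.Definitions using (Symmetric)
open import Relation.Binary.PropositionalEquality
  using (_≡_; _≢_; refl; sym; trans; cong; cong₂; subst; subst₂; setoid; module ≡-Reasoning)
open import Relation.Nullary using (¬_; yes; no)
open import Relation.Unary using (Pred; _∪_)

private
  variable
    A : Set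
    x y z u v w : Str

levi : (xs ys xs' ys' : List A) → xs ++ ys ≡ xs' ++ ys' →
  (∃[ r ] (xs' ≡ xs ++ r × ys ≡ r ++ ys')) ⊎ (∃[ r ] (xs ≡ xs' ++ r × ys' ≡ r ++ ys))
levi []       ys xs'        ys' e = inj₁ (xs' , refl , e)
levi (x ∷ xs) ys []         ys' e = inj₂ (x ∷ xs , refl , sym e)
levi (x ∷ xs) ys (x' ∷ xs') ys' e with ∷-injective e
... | refl , e' with levi xs ys xs' ys' e'
...   | inj₁ (r , refl , p) = inj₁ (r , refl , p)
...   | inj₂ (r , refl , p) = inj₂ (r , refl , p)

⊑-suffix : ∀ r x → x ⊑ (r ++ x)
⊑-suffix r x = r , [] , cong (r ++_) (++-identityʳ x)

⊑-trans : x ⊑ y → y ⊑ z → x ⊑ z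
⊑-trans {x} (p , q , refl) (r , s , refl) = r ++ p , q ++ s , (begin
  (r ++ p) ++ x ++ q ++ s   ≡⟨ ++-assoc r p _ ⟩
  r ++ p ++ x ++ q ++ s     ≡⟨ cong (λ t → r ++ p ++ t) (++-assoc x q s) ⟨
  r ++ p ++ (x ++ q) ++ s   ≡⟨ cong (r ++_) (++-assoc p (x ++ q) s) ⟨
  r ++ (p ++ x ++ q) ++ s   ∎)
  where open ≡-Reasoning

Incomparable : Str → Str → Set
Incomparable x y = ¬ x ⊑ y × ¬ y ⊑ x

incomparable-sym : Symmetric Incomparable
incomparable-sym (x⋢y , y⋢x) = y⋢x , x⋢y

suffixes-comparable : Suffix x z → Suffix y z → x ⊑ y ⊎ y ⊑ x
suffixes-comparable {x} {y = y} (γ , refl) (γ' , e) with levi γ x γ' y (sym e)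
... | inj₁ (r , _ , x≡ry) = inj₂ (subst (y ⊑_) (sym x≡ry) (⊑-suffix r y))
... | inj₂ (r , _ , y≡rx) = inj₁ (subst (x ⊑_) (sym y≡rx) (⊑-suffix r x))

comp-involutive : ∀ b → comp (comp b) ≡ b
comp-involutive a = refl
comp-involutive t = refl
comp-involutive g = refl
comp-involutive c = refl

rc-++ : ∀ x y → rc (x ++ y) ≡ rc y ++ rc x
rc-++ x y = trans (cong reverse (map-++ comp x y)) (reverse-++ (map comp x) (map comp y))

rc-involutive : ∀ x → rc (rc x) ≡ x
rc-involutive x = begin
  reverse (map comp (reverse (map comp x)))  ≡⟨ cong reverse (reverse-map comp (map comp x)) ⟩
  reverse (reverse (map comp (map comp x)))  ≡⟨ reverse-involutive _ ⟩
  map comp (map comp x)                      ≡⟨ map-∘ x ⟨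
  map (comp ∘ comp) x                        ≡⟨ map-cong comp-involutive x ⟩
  map (λ b → b) x                            ≡⟨ map-id x ⟩
  x                                          ∎
  where open ≡-Reasoning

length-rc : ∀ x → length (rc x) ≡ length x
length-rc x = trans (length-reverse (map comp x)) (length-map comp x)

rc-⊑ : x ⊑ y → rc x ⊑ rc y
rc-⊑ {x} (p , q , refl) = rc q , rc p , sym (begin
  rc (p ++ x ++ q)        ≡⟨ rc-++ p (x ++ q) ⟩
  rc (x ++ q) ++ rc p     ≡⟨ cong (_++ rc p) (rc-++ x q) ⟩
  (rc q ++ rc x) ++ rc p  ≡⟨ ++-assoc (rc q) (rc x) (rc p) ⟩
  rc q ++ rc x ++ rc p    ∎)
  where open ≡-Reasoning

module Walks (weight : A → A → ℕ) where

  pathWeight : List A → ℕ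
  pathWeight (x ∷ y ∷ xs) = weight x y + pathWeight (y ∷ xs)
  pathWeight _            = 0

  cycleWeight : List A → ℕ
  cycleWeight xs = sum (zipWith weight xs (rot 1 xs))

  pathWeight-++ : ∀ xs e ys → pathWeight (xs ++ e ∷ ys) ≡ pathWeight (xs ∷ʳ e) + pathWeight (e ∷ ys)
  pathWeight-++ []            e ys = refl
  pathWeight-++ (x ∷ [])      e ys = cong (_+ pathWeight (e ∷ ys)) (sym (+-identityʳ (weight x e)))
  pathWeight-++ (x ∷ x' ∷ xs) e ys =
    trans (cong (weight x x' +_) (pathWeight-++ (x' ∷ xs) e ys)) (sym (+-assoc (weight x x') _ _))

  sum-zipWith-∷ʳ : ∀ x xs y → sum (zipWith weight (x ∷ xs) (xs ∷ʳ y)) ≡ pathWeight (x ∷ xs ∷ʳ y)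
  sum-zipWith-∷ʳ x []        y = refl
  sum-zipWith-∷ʳ x (x' ∷ xs) y = cong (weight x x' +_) (sum-zipWith-∷ʳ x' xs y)

  cycleWeight-closed : ∀ x xs → cycleWeight (x ∷ xs) ≡ pathWeight (x ∷ xs ∷ʳ x)
  cycleWeight-closed x xs = sum-zipWith-∷ʳ x xs x

  cycleWeight-swap : ∀ xs ys → cycleWeight (xs ++ ys) ≡ cycleWeight (ys ++ xs)
  cycleWeight-swap []       ys       = cong cycleWeight (sym (++-identityʳ ys))
  cycleWeight-swap (x ∷ xs) []       = cong cycleWeight (++-identityʳ (x ∷ xs))
  cycleWeight-swap (x ∷ xs) (y ∷ ys) = begin
    cycleWeight (x ∷ xs ++ y ∷ ys)                       ≡⟨ cycleWeight-closed x (xs ++ y ∷ ys) ⟩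
    pathWeight (x ∷ (xs ++ y ∷ ys) ∷ʳ x)                 ≡⟨ cong (pathWeight ∘ (x ∷_)) (++-assoc xs (y ∷ ys) [ x ]) ⟩
    pathWeight ((x ∷ xs) ++ y ∷ (ys ∷ʳ x))               ≡⟨ pathWeight-++ (x ∷ xs) y (ys ∷ʳ x) ⟩
    pathWeight (x ∷ xs ∷ʳ y) + pathWeight (y ∷ ys ∷ʳ x)  ≡⟨ +-comm (pathWeight (x ∷ xs ∷ʳ y)) _ ⟩
    pathWeight (y ∷ ys ∷ʳ x) + pathWeight (x ∷ xs ∷ʳ y)  ≡⟨ pathWeight-++ (y ∷ ys) x (xs ∷ʳ y) ⟨
    pathWeight ((y ∷ ys) ++ x ∷ (xs ∷ʳ y))               ≡⟨ cong (pathWeight ∘ (y ∷_)) (++-assoc ys (x ∷ xs) [ y ]) ⟨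
    pathWeight (y ∷ (ys ++ x ∷ xs) ∷ʳ y)                 ≡⟨ cycleWeight-closed y (ys ++ x ∷ xs) ⟨
    cycleWeight (y ∷ ys ++ x ∷ xs)                       ∎
    where open ≡-Reasoning

  cycleWeight-rot : ∀ k xs → cycleWeight (rot k xs) ≡ cycleWeight xs
  cycleWeight-rot k xs =
    trans (cycleWeight-swap (drop k xs) (take k xs)) (cong cycleWeight (take++drop≡id k xs))

open Walks dist

ovFrom-spec : ∀ k x y → drop (length x ∸ ovFrom k x y) x ≡ take (ovFrom k x y) y
ovFrom-spec zero    x y = drop-all (length x) x ≤-refl
ovFrom-spec (suc k) x y with drop (length x ∸ suc k) x ≟S take (suc k) y
... | yes eq = eq
... | no  _  = ovFrom-spec k x y

ov-spec : ∀ x y → drop (length x ∸ ov x y) x ≡ take (ov x y) y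
ov-spec x y = ovFrom-spec (pred (length x ⊓ length y)) x y

pref-++ : ∀ x y → pref x y ++ y ≡ x ++ drop (ov x y) y
pref-++ x y = begin
  take j x ++ y                        ≡⟨ cong (take j x ++_) (take++drop≡id o y) ⟨
  take j x ++ take o y ++ drop o y     ≡⟨ cong (λ s → take j x ++ s ++ drop o y) (ov-spec x y) ⟨
  take j x ++ drop j x ++ drop o y     ≡⟨ ++-assoc (take j x) (drop j x) _ ⟨
  (take j x ++ drop j x) ++ drop o y   ≡⟨ cong (_++ drop o y) (take++drop≡id j x) ⟩
  x ++ drop o y                        ∎
  where
  open ≡-Reasoning
  o = ov x y
  j = length x ∸ o

length-pref : ∀ x y → length (pref x y) ≡ dist x y
length-pref x y = trans (length-take (length x ∸ ov x y) x) (m≤n⇒m⊓n≡m (m∸n≤m (length x) (ov x y)))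

merge-head : ∀ x xs → ∃[ r ] (merge (x ∷ xs) ≡ x ++ r)
merge-head x []       = [] , sym (++-identityʳ x)
merge-head x (y ∷ ys) with merge-head y ys
... | r , e = drop (ov x y) y ++ r , (begin
  pref x y ++ merge (y ∷ ys)    ≡⟨ cong (pref x y ++_) e ⟩
  pref x y ++ y ++ r            ≡⟨ ++-assoc (pref x y) y r ⟨
  (pref x y ++ y) ++ r          ≡⟨ cong (_++ r) (pref-++ x y) ⟩
  (x ++ drop (ov x y) y) ++ r   ≡⟨ ++-assoc x _ r ⟩
  x ++ drop (ov x y) y ++ r     ∎)
  where open ≡-Reasoning

merge-last : ∀ xs y → Suffix y (merge (xs ∷ʳ y))
merge-last []            y = [] , refl
merge-last (x ∷ [])      y = pref x y , refl
merge-last (x ∷ x' ∷ xs) y with merge-last (x' ∷ xs) y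
... | r , e = pref x x' ++ r , trans (++-assoc (pref x x') r y) (cong (pref x x' ++_) e)

length-merge : ∀ xs y → length (merge (xs ∷ʳ y)) ≡ pathWeight (xs ∷ʳ y) + length y
length-merge []            y = refl
length-merge (x ∷ [])      y =
  trans (length-++ (pref x y)) (cong (_+ length y) (trans (length-pref x y) (sym (+-identityʳ (dist x y)))))
length-merge (x ∷ x' ∷ xs) y = begin
  length (pref x x' ++ merge (x' ∷ xs ∷ʳ y))              ≡⟨ length-++ (pref x x') ⟩
  length (pref x x') + length (merge (x' ∷ xs ∷ʳ y))      ≡⟨ cong₂ _+_ (length-pref x x') (length-merge (x' ∷ xs) y) ⟩
  dist x x' + (pathWeight (x' ∷ xs ∷ʳ y) + length y)      ≡⟨ +-assoc (dist x x') _ _ ⟨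
  dist x x' + pathWeight (x' ∷ xs ∷ʳ y) + length y        ∎
  where open ≡-Reasoning

record Bordered : Set where
  field
    border right left : Str
    two-sided : border ++ right ≡ left ++ border

  whole : Str
  whole = border ++ right

  length-left : length left ≡ length right
  length-left = +-cancelˡ-≡ (length border) _ _ (begin
    length border + length left   ≡⟨ +-comm (length border) _ ⟩
    length left + length border   ≡⟨ length-++ left ⟨
    length (left ++ border)       ≡⟨ cong length two-sided ⟨
    length (border ++ right)      ≡⟨ length-++ border ⟩
    length border + length right  ∎)
    where open ≡-Reasoning

open Bordered

rcBordered : Bordered → Bordered
rcBordered b = record
  { border = rc (border b) ; right = rc (left b) ; left = rc (right b)
  ; two-sided = trans (sym (rc-++ (left b) (border b)))
                      (trans (cong rc (sym (two-sided b))) (rc-++ (border b) (right b))) }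

whole-rcBordered : ∀ b → whole (rcBordered b) ≡ rc (whole b)
whole-rcBordered b = trans (sym (rc-++ (left b) (border b))) (cong rc (sym (two-sided b)))

rotation-bordered : ∀ k (L : List Str) {u rest} → rot k L ≡ u ∷ rest →
  ∃[ b ] (border b ≡ u × whole b ≡ merge (u ∷ (rest ∷ʳ u)) × length (right b) ≡ cycleWeight L)
rotation-bordered k L {u} {rest} rotL with merge-head u (rest ∷ʳ u) | merge-last (u ∷ rest) u
... | Q , y≡uQ | Q' , Q'u≡y =
  record { border = u ; right = Q ; left = Q' ; two-sided = trans (sym y≡uQ) (sym Q'u≡y) } ,
  refl , sym y≡uQ , +-cancelˡ-≡ (length u) _ _ (begin
    length u + length Q                         ≡⟨ length-++ u ⟨
    length (u ++ Q)                             ≡⟨ cong length y≡uQ ⟨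
    length (merge (u ∷ rest ∷ʳ u))              ≡⟨ length-merge (u ∷ rest) u ⟩
    pathWeight (u ∷ rest ∷ʳ u) + length u       ≡⟨ cong (_+ length u) (cycleWeight-closed u rest) ⟨
    cycleWeight (u ∷ rest) + length u           ≡⟨ cong (λ l → cycleWeight l + length u) rotL ⟨
    cycleWeight (rot k L) + length u            ≡⟨ cong (_+ length u) (cycleWeight-rot k L) ⟩
    cycleWeight L + length u                    ≡⟨ +-comm (cycleWeight L) _ ⟩
    length u + cycleWeight L                    ∎)
  where open ≡-Reasoning

module _ {P : Pred A 0ℓ} where

  sum-map-─ : (f : A → ℕ) {xs : List A} (p : Any P xs) →
    sum (map f xs) ≡ f (Any.lookup p) + sum (map f (xs ─ p))
  sum-map-─ f (here _) = refl
  sum-map-─ f {x ∷ _} (there p) =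
    trans (cong (f x +_) (sum-map-─ f p)) (x∙yz≈y∙xz (f x) (f (Any.lookup p)) _)

  AllPairs-─ : ∀ {R : A → A → Set} {xs} (p : Any P xs) → AllPairs R xs → AllPairs R (xs ─ p)
  AllPairs-─ (here _)  (_ ∷ rs)  = rs
  AllPairs-─ (there p) (rx ∷ rs) = ─⁺ p rx ∷ AllPairs-─ p rs

  AllPairs-lookup-─ : ∀ {R : A → A → Set} → Symmetric R → ∀ {xs} (p : Any P xs) →
    AllPairs R xs → All (R (Any.lookup p)) (xs ─ p)
  AllPairs-lookup-─ R-sym (here _)  (rx ∷ _)  = rx
  AllPairs-lookup-─ R-sym (there p) (rx ∷ rs) = R-sym (proj₁ (All.lookupAny rx p)) ∷ AllPairs-lookup-─ R-sym p rs

Any-or-All : ∀ {P Q : Pred A 0ℓ} {xs} → All (P ∪ Q) xs → Any P xs ⊎ All Q xs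
Any-or-All []              = inj₂ []
Any-or-All (inj₁ px ∷ _)   = inj₁ (here px)
Any-or-All (inj₂ qx ∷ pqs) with Any-or-All pqs
... | inj₁ p  = inj₁ (there p)
... | inj₂ qs = inj₂ (qx ∷ qs)

-- v occurs in z ++ w, its occurrence ending inside w or right at its start
EndsIn : Str → Str → Str → Set
EndsIn z w v = ∃[ γ ] ∃[ w₁ ] ∃[ w₂ ] (w ≡ w₁ ++ w₂ × γ ++ v ≡ z ++ w₁)

-- ... ending strictly inside w
EndsAfter : Str → Str → Str → Set
EndsAfter z []      v = ⊥
EndsAfter z (ch ∷ w) v = EndsIn (z ∷ʳ ch) w v

suffix-or-endsAfter : ∀ z w → EndsIn z w v → Suffix v z ⊎ EndsAfter z w v
suffix-or-endsAfter z w  (γ , []     , w₂ , _    , e) = inj₁ (γ , trans e (++-identityʳ z))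
suffix-or-endsAfter z ._ (γ , ch ∷ w₁ , w₂ , refl , e) =
  inj₂ (γ , w₁ , w₂ , refl , trans e (sym (++-assoc z [ ch ] w₁)))

-- An occurrence of v ending after one of u starts after it, as u ⋢ v.
endsAfter-rebase : ∀ w → Suffix u z → Incomparable u v → EndsAfter z w v → EndsAfter u w v
endsAfter-rebase {u} {v = v} (ch ∷ w) (γ , refl) (u⋢v , _) (γ' , w₁ , w₂ , w≡ , e)
  with levi γ' v γ (u ++ ch ∷ w₁) (trans e (trans (++-assoc (γ ++ u) [ ch ] w₁) (++-assoc γ u (ch ∷ w₁))))
... | inj₁ (r , _ , v≡) = ⊥-elim (u⋢v (r , ch ∷ w₁ , sym v≡))
... | inj₂ (r , _ , e') = r , w₁ , w₂ , w≡ , trans (sym e') (sym (++-assoc u [ ch ] w₁))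

extent : List Bordered → ℕ
extent bs = sum (map (length ∘ right) bs)

Inserted : Str → Str → List Bordered → Set
Inserted z w bs = ∃[ W ] (length W ≤ length w + extent bs × All (λ b → whole b ⊑ (z ++ W)) bs)

Borders-incomparable : List Bordered → Set
Borders-incomparable = AllPairs (Incomparable on border)

-- If the border β of b ends where z = γ ++ β ends, then
-- z ++ right b ++ P = γ ++ whole b ++ P = γ ++ left b ++ β ++ P contains both
-- whole b and β ++ P, where the other strings were inserted.
insert-after-border : ∀ {z w bs} (p : Any (λ b → Suffix (border b) z) bs) →
  Inserted (border (Any.lookup p)) w (bs ─ p) → Inserted z w bs
insert-after-border {z} {w} {bs} p (P , bound , found) with lookup-result p
... | γ , γu≡z =
  right b ++ P , bound′ , ─⁻ p (γ , P , sym around-whole) (All.map (λ h → ⊑-trans h around-β) found)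
  where
  open ≡-Reasoning
  b = Any.lookup p
  β = border b
  around-whole : z ++ right b ++ P ≡ γ ++ whole b ++ P
  around-whole = begin
    z ++ right b ++ P          ≡⟨ cong (_++ right b ++ P) γu≡z ⟨
    (γ ++ β) ++ right b ++ P   ≡⟨ ++-assoc γ β _ ⟩
    γ ++ β ++ right b ++ P     ≡⟨ cong (γ ++_) (++-assoc β (right b) P) ⟨
    γ ++ whole b ++ P          ∎
  around-β : (β ++ P) ⊑ (z ++ right b ++ P)
  around-β = γ ++ left b , [] , (begin
    (γ ++ left b) ++ (β ++ P) ++ []   ≡⟨ cong ((γ ++ left b) ++_) (++-identityʳ (β ++ P)) ⟩
    (γ ++ left b) ++ β ++ P           ≡⟨ ++-assoc γ (left b) (β ++ P) ⟩
    γ ++ left b ++ β ++ P             ≡⟨ cong (γ ++_) (++-assoc (left b) β P) ⟨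
    γ ++ (left b ++ β) ++ P           ≡⟨ cong (λ s → γ ++ s ++ P) (two-sided b) ⟨
    γ ++ whole b ++ P                 ≡⟨ around-whole ⟨
    z ++ right b ++ P                 ∎)
  bound′ : length (right b ++ P) ≤ length w + extent bs
  bound′ = subst₂ _≤_ (sym (length-++ (right b)))
    (trans (x∙yz≈y∙xz (length (right b)) (length w) _)
           (cong (length w +_) (sym (sum-map-─ (length ∘ right) p))))
    (+-monoʳ-≤ (length (right b)) bound)

-- Occurrences of incomparable strings are never nested, so the others start
-- after the start of the border of b and end after its end.
others-endAfter : ∀ z w {bs} → Borders-incomparable bs → All (EndsIn z w ∘ border) bs →
  (p : Any (λ b → Suffix (border b) z) bs) → All (EndsAfter (border (Any.lookup p)) w ∘ border) (bs ─ p)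
others-endAfter z w inc occ p = All.zipWith (λ {e} → rebase {e})
  (AllPairs-lookup-─ {R = Incomparable on border} incomparable-sym p inc , ─⁺ p occ)
  where
  b = Any.lookup p
  rebase : ∀ {e} → Incomparable (border b) (border e) × EndsIn z w (border e) → EndsAfter (border b) w (border e)
  rebase (b⋈e , occ-e) with suffix-or-endsAfter z w occ-e
  ... | inj₂ after-e = endsAfter-rebase w (lookup-result p) b⋈e after-e
  ... | inj₁ suffix-e with suffixes-comparable (lookup-result p) suffix-e
  ...   | inj₁ b⊑e = ⊥-elim (proj₁ b⋈e b⊑e)
  ...   | inj₂ e⊑b = ⊥-elim (proj₂ b⋈e e⊑b)

mutual
  insert : ∀ z w bs → Borders-incomparable bs → All (EndsIn z w ∘ border) bs → Inserted z w bs
  insert z w bs inc occ with Any-or-All (All.map (suffix-or-endsAfter z w) occ)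
  ... | inj₂ after = advance z w bs inc after
  ... | inj₁ p     =
    insert-after-border {z} {w} p (advance _ w (bs ─ p) (AllPairs-─ p inc) (others-endAfter z w inc occ p))

  advance : ∀ z w bs → Borders-incomparable bs → All (EndsAfter z w ∘ border) bs → Inserted z w bs
  advance z []      []  _   []    = [] , z≤n , []
  advance z (ch ∷ w) bs  inc after with insert (z ∷ʳ ch) w bs inc after
  ... | P , bound , found = ch ∷ P , s≤s bound , All.map (subst (_ ⊑_) (++-assoc z [ ch ] P)) found

insert-borders : ∀ w bs → Borders-incomparable bs → All (λ b → border b ⊑ w) bs →
  ∃[ W ] (length W ≤ length w + extent bs × All (λ b → whole b ⊑ W) bs)
insert-borders w bs inc occ = insert [] w bs inc (All.map endsIn occ)
  where
  endsIn : u ⊑ w → EndsIn [] w u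
  endsIn {u} (γ , δ , e) = γ , γ ++ u , δ , trans (sym e) (sym (++-assoc γ u δ)) , refl

Unique-++-disjoint : ∀ (xs : List A) {ys} → Unique (xs ++ ys) → ∀ {v} → v ∈ xs → v ∈ ys → ⊥
Unique-++-disjoint (x ∷ xs) (x∉ ∷ _) (here refl)  v∈ys = All.lookup x∉ (∈-++⁺ʳ xs v∈ys) refl
Unique-++-disjoint (x ∷ xs) (_ ∷ u)  (there v∈xs) v∈ys = Unique-++-disjoint xs u v∈xs v∈ys

Unique-++⁻ʳ : ∀ (xs : List A) {ys} → Unique (xs ++ ys) → Unique ys
Unique-++⁻ʳ []       u       = u
Unique-++⁻ʳ (_ ∷ xs) (_ ∷ u) = Unique-++⁻ʳ xs u

concat-tabulate-disjoint : ∀ {m} (F : Fin m → List A) → Unique (concat (tabulate F)) →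
  ∀ {d d'} → d ≢ d' → ∀ {v} → v ∈ F d → v ∈ F d' → ⊥
concat-tabulate-disjoint F u {zero}  {zero}   d≢d' _ _ = d≢d' refl
concat-tabulate-disjoint F u {zero}  {suc e'} _ v∈Fd v∈Fd' =
  Unique-++-disjoint (F zero) u v∈Fd (∈-concat⁺′ v∈Fd' (∈-tabulate⁺ e'))
concat-tabulate-disjoint F u {suc e} {zero}   _ v∈Fd v∈Fd' =
  Unique-++-disjoint (F zero) u v∈Fd' (∈-concat⁺′ v∈Fd (∈-tabulate⁺ e))
concat-tabulate-disjoint F u {suc e} {suc e'} d≢d' =
  concat-tabulate-disjoint (F ∘ suc) (Unique-++⁻ʳ (F zero) u) (d≢d' ∘ cong suc)

module _ {n : ℕ} where

  open import Data.List.Relation.Binary.Permutation.Setoid.Properties (setoid (Fin n)) using (Unique-resp-↭)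

  cover-indices-disjoint : ∀ {m} {CC : Fin m → Cycle n} → IsCycleCover CC →
    ∀ {d d'} → d ≢ d' → ∀ {i} → i ∈ map proj₁ (CC d) → i ∈ map proj₁ (CC d') → ⊥
  cover-indices-disjoint {CC = CC} (_ , indices↭) = concat-tabulate-disjoint (map proj₁ ∘ CC) unique
    where
    unique : Unique (concat (tabulate (map proj₁ ∘ CC)))
    unique = subst Unique (trans (sym (concat-map (tabulate CC))) (cong concat (map-tabulate CC (map proj₁))))
                      (Unique-resp-↭ (↭⇒↭ₛ (↭-sym indices↭)) (allFin⁺ n))

rot-↭ : ∀ k (xs : List A) → rot k xs ↭ xs
rot-↭ k xs = ↭-trans (↭.++-comm (drop k xs) (take k xs)) (↭-reflexive (take++drop≡id k xs))

module Anchoring {n : ℕ} (S : Fin n → Str) where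

  rc-orient : ∀ i o → rc (orient S (i , o)) ≡ orient S (i , not o)
  rc-orient i true  = refl
  rc-orient i false = rc-involutive (S i)

  orient-⊑-solution : IsSol S w → ∀ i o → orient S (i , o) ⊑ w ⊎ orient S (i , not o) ⊑ w
  orient-⊑-solution sol i true = sol i
  orient-⊑-solution sol i false with sol i
  ... | inj₁ s = inj₂ s
  ... | inj₂ s = inj₁ s

  record Anchor (w : Str) (C : Cycle n) (x : Str) : Set where
    field
      tile        : Bordered
      index       : Fin n
      orientation : Bool
      index∈C     : index ∈ map proj₁ C
      border≡     : border tile ≡ orient S (index , orientation)
      border⊑w    : border tile ⊑ w
      covers      : x ⊑ whole tile ⊎ rc x ⊑ whole tile
      weight≡     : length (right tile) ≡ cycW S C

  open Anchor

  anchor : ∀ {C} → IsSol S w → RotationString (cycStrs S C) x → Anchor w C x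
  anchor {w} {x} {C} sol (k , u , rest , _ , rotC , _ , x⊑y)
    with rotation-bordered k (cycStrs S C) rotC
       | ∈-map⁻ (orient S) (∈-resp-↭ (rot-↭ k (cycStrs S C)) (subst (u ∈_) (sym rotC) (here refl)))
  ... | b , refl , whole≡y , weight-b | (i , o) , v∈C , u≡ with orient-⊑-solution sol i o
  ...   | inj₁ o⊑w = record
    { tile = b ; index = i ; orientation = o ; index∈C = ∈-map⁺ proj₁ v∈C ; border≡ = u≡
    ; border⊑w = subst (_⊑ w) (sym u≡) o⊑w
    ; covers = inj₁ (subst (x ⊑_) (sym whole≡y) x⊑y)
    ; weight≡ = weight-b }
  ...   | inj₂ flipped⊑w = record
    { tile = rcBordered b ; index = i ; orientation = not o ; index∈C = ∈-map⁺ proj₁ v∈C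
    ; border≡ = rc-border≡
    ; border⊑w = subst (_⊑ w) (sym rc-border≡) flipped⊑w
    ; covers = inj₂ (subst (rc x ⊑_) (sym (trans (whole-rcBordered b) (cong rc whole≡y))) (rc-⊑ x⊑y))
    ; weight≡ = trans (length-rc (left b)) (trans (length-left b) weight-b) }
    where
    rc-border≡ : rc (border b) ≡ orient S (i , not o)
    rc-border≡ = trans (cong rc u≡) (rc-orient i o)

  anchor-border-⋢ : WellIndexed S → SubstringFree S → ∀ {m} {CC : Fin m → Cycle n} {x : Fin m → Str} →
    IsCycleCover CC → (α : ∀ d → Anchor w (CC d) (x d)) →
    ∀ {d d'} → d ≢ d' → ¬ border (tile (α d)) ⊑ border (tile (α d'))
  anchor-border-⋢ WI SF {CC = CC} cover α {d} {d'} d≢d' ⊑' =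
    cover-indices-disjoint cover d≢d' (index∈C (α d))
      (subst (_∈ map proj₁ (CC d')) (sym same-index) (index∈C (α d')))
    where
    vd = (index (α d) , orientation (α d))
    vd' = (index (α d') , orientation (α d'))
    same-index : index (α d) ≡ index (α d')
    same-index = WI vd vd' (SF vd vd' (subst₂ _⊑_ (border≡ (α d)) (border≡ (α d')) ⊑'))

  anchors-incomparable : WellIndexed S → SubstringFree S → ∀ {m} {CC : Fin m → Cycle n} {x : Fin m → Str} →
    IsCycleCover CC → (α : ∀ d → Anchor w (CC d) (x d)) →
    ∀ {d d'} → d ≢ d' → Incomparable (border (tile (α d))) (border (tile (α d')))
  anchors-incomparable WI SF cover α d≢d' =
    anchor-border-⋢ WI SF cover α d≢d' , anchor-border-⋢ WI SF cover α (d≢d' ∘ sym)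

  module _ {m} {CC : Fin m → Cycle n} {x : Fin m → Str} (α : ∀ d → Anchor w (CC d) (x d)) where

    anchors-solve : ∀ {W} → All (λ b → whole b ⊑ W) (tabulate (tile ∘ α)) → IsSol x W
    anchors-solve found d = Sum.map (λ x⊑ → ⊑-trans x⊑ y⊑W) (λ rcx⊑ → ⊑-trans rcx⊑ y⊑W) (covers (α d))
      where
      y⊑W = tabulate⁻ found d

    extent-anchors : extent (tabulate (tile ∘ α)) ≡ coverW S CC
    extent-anchors = cong sum (trans (map-tabulate (tile ∘ α) (length ∘ right)) (tabulate-cong (weight≡ ∘ α)))

lemma17 : ∀ {n m} (S : Fin n → Str) → WellIndexed S → SubstringFree S →
    (CC : Fin m → Cycle n) → IsMinCycleCover S CC →
    (x : Fin m → Str) →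
    (∀ d → RotationString (cycStrs S (CC d)) (x d)) →
    (∀ d e → d ≢ e → 2 * ov (x d) (x e) ≤ 2 * cycW S (CC d) + cycW S (CC e)) →
    ∀ (optA optS : ℕ) → IsOPT x optA → IsOPT S optS →
    optA ≤ optS + coverW S CC
lemma17 S WI SF CC (cover , _) x rotations _ optA optS (_ , optA-minimal) ((w , sol , refl) , _) =
  let W , W-short , W-covers = insert-borders w (tabulate (tile ∘ α))
                                 (AllPairsₚ.tabulate⁺ (anchors-incomparable WI SF cover α))
                                 (tabulate⁺ (border⊑w ∘ α))
  in ≤-trans (optA-minimal W (anchors-solve α W-covers))
             (subst (λ e → length W ≤ length w + e) (extent-anchors α) W-short)
  where
  open Anchoring S
  open Anchor
  α : ∀ d → Anchor w (CC d) (x d)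
  α d = anchor sol (rotations d)
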